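{- If $G$ is a randomly $k$-dimensional graph of order $n$ and diameter $d$, then $k\geq \frac{n-1}{d}$.
   Context: All graphs are finite, simple and connected; the diameter is the maximum distance between two vertices. For an ordered set $W=\{w_1,\dots,w_k\}\subseteq V(G)$ and $v\in V(G)$, $r(v|W)=(d(v,w_1),\dots,d(v,w_k))$, where $d$ denotes graph distance. $W$ is a resolving set if distinct vertices have distinct representations with respect to $W$; a basis is a minimum-size resolving set and its size is the metric dimension $\beta(G)$. $G$ is randomly $k$-dimensional if $\beta(G)=k$ and every $k$-subset of $V(G)$ is a basis of $G$. -}

module Defs where

open import Level using (0ℓ)
open import Data.Nat using (ℕ; zero; suc; _≤_; _<_)
open import Data.Fin using (Fin)
open import Data.Fin.Subset using (Subset; _∈_; ∣_∣)
open import Data.Product using (Σ; ∃; ∃-syntax; _×_)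
open import Relation.Nullary using (¬_)
open import Relation.Binary.PropositionalEquality using (_≡_)

record Graph (n : ℕ) : Set₁ where
  field
    Adj       : Fin n → Fin n → Set
    sym       : ∀ {u v} → Adj u v → Adj v u
    irrefl    : ∀ {u} → ¬ Adj u u

open Graph public

data Walk {n : ℕ} (G : Graph n) : Fin n → Fin n → ℕ → Set where
  [] : ∀ {u} → Walk G u u zero
  _∷_ : ∀ {u v w m} → Adj G u v → Walk G v w m → Walk G u w (suc m)

Dist : ∀ {n} → Graph n → Fin n → Fin n → ℕ → Set
Dist G u v m = Walk G u v m × (∀ l → l < m → ¬ Walk G u v l)

Connected : ∀ {n} → Graph n → Set
Connected G = ∀ u v → ∃[ m ] Walk G u v m

Diameter : ∀ {n} → Graph n → ℕ → Set
Diameter G d = (∃[ u ] ∃[ v ] Dist G u v d)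
             × (∀ u v m → Dist G u v m → m ≤ d)

SameDist : ∀ {n} → Graph n → Fin n → Fin n → Fin n → Set
SameDist G u v w = ∃[ m ] (Dist G u w m × Dist G v w m)

Resolving : ∀ {n} → Graph n → Subset n → Set
Resolving G W = ∀ u v → (∀ w → w ∈ W → SameDist G u v w) → u ≡ v

IsBasis : ∀ {n} → Graph n → Subset n → Set
IsBasis G W = Resolving G W × (∀ W' → Resolving G W' → ∣ W ∣ ≤ ∣ W' ∣)

MetricDim : ∀ {n} → Graph n → ℕ → Set
MetricDim G k = (∃[ W ] (IsBasis G W × ∣ W ∣ ≡ k))

RandomlyKDim : ∀ {n} → Graph n → ℕ → Set
RandomlyKDim G k = MetricDim G k × (∀ W → ∣ W ∣ ≡ k → IsBasis G W)

module Submission where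

-- Idea (double counting).  Call a vertex z a "witness of agreement" for a pair
-- (u , v) when d(u,z) = d(v,z), and let agree(u,v) be the number of such z.
--   * Upper bound.  In a randomly k-dimensional graph every k-set resolves, so
--     two distinct vertices have fewer than k witnesses (k of them would form a
--     non-resolving k-set).  Hence Σ_v agree(u,v) ≤ n + n(k-1) = n k for all u.
--   * Lower bound.  Exchanging the order of summation, Σ_u Σ_v agree(u,v) is
--     Σ_z Σ_j s_j(z)², where s_j(z) counts the vertices at distance j from z.
--     For fixed z we have s_0(z) = 1 and Σ_{1≤j≤d} s_j(z) = n - 1, so by
--     Cauchy–Schwarz Σ_j s_j(z)² ≥ 1 + (n-1)²/d.
--   * Comparing: n (d + (n-1)²) ≤ d n² k, which forces n - 1 ≤ k d.  Adjacency is not assumed decidable; since the conclusion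
-- is a decidable inequality, it suffices to prove it from the (doubly negated,
-- hence harmless) decidability of adjacency on the finite vertex set.

open import Data.Bool using (if_then_else_)
open import Data.Nat using (ℕ; zero; suc; _+_; _*_; _∸_; _≤_; _<_; z≤n; s≤s; _≟_; _≤?_; anyUpTo?)
open import Data.Nat.Properties
open import Data.Nat.Induction using (<-rec)
open import Data.Nat.Tactic.RingSolver using (solve-∀)
open import Data.Fin using (Fin; toℕ) renaming (zero to fzero; suc to fsuc)
import Data.Fin.Properties as Fin
open import Data.Fin.Subset using (_∈_; ∣_∣; inside; outside; ⊥)
open import Data.Fin.Subset.Properties using (∉⊥; ∣⊥∣≡0)
open import Data.Vec.Base using ([]; _∷_; here; there)
open import Data.Product using (∃-syntax; _×_; _,_; proj₁; proj₂)
open import Data.Sum using (inj₁; inj₂)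
open import Function using (_∘_)
open import Relation.Nullary using (Dec; yes; no; does; ¬_; contradiction)
open import Relation.Nullary.Decidable using (decidable-stable; ¬¬-excluded-middle; _×-dec_)
open import Relation.Binary.PropositionalEquality
open import Algebra.Properties.Semiring.Sum +-*-semiring
  using (sum; sum-syntax; sum-cong-≗; ∑-distrib-+; ∑-comm; *-distribˡ-sum; *-distribʳ-sum)
open import Defs hiding (sym)

-- The indicator of a decided proposition: 1 if it holds, 0 otherwise.
-- Defined through 'does' so that it computes on closed decisions.
𝟙 : {P : Set} → Dec P → ℕ
𝟙 P? = if does P? then 1 else 0

𝟙-yes : {P : Set} (P? : Dec P) → P → 𝟙 P? ≡ 1
𝟙-yes (yes _) _ = refl
𝟙-yes (no ¬p) p = contradiction p ¬p

𝟙-no : {P : Set} (P? : Dec P) → ¬ P → 𝟙 P? ≡ 0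
𝟙-no (yes p) ¬p = contradiction p ¬p
𝟙-no (no _)  _  = refl

𝟙≤1 : {P : Set} (P? : Dec P) → 𝟙 P? ≤ 1
𝟙≤1 (yes _) = s≤s z≤n
𝟙≤1 (no _)  = z≤n

𝟙-cong : {P Q : Set} (P? : Dec P) (Q? : Dec Q) → (P → Q) → (Q → P) → 𝟙 P? ≡ 𝟙 Q?
𝟙-cong (yes p) Q? to _    = sym (𝟙-yes Q? (to p))
𝟙-cong (no ¬p) Q? _  from = sym (𝟙-no Q? (¬p ∘ from))

sum-const : ∀ n c → ∑[ i < n ] c ≡ n * c
sum-const zero    c = refl
sum-const (suc n) c = cong (c +_) (sum-const n c)

sum-mono : ∀ {n} {f g : Fin n → ℕ} → (∀ i → f i ≤ g i) → sum f ≤ sum g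
sum-mono {zero}  _   = z≤n
sum-mono {suc n} f≤g = +-mono-≤ (f≤g fzero) (sum-mono (f≤g ∘ fsuc))

sum-select : ∀ {m} x (g : ℕ → ℕ) → x < m → ∑[ j < m ] (𝟙 (toℕ j ≟ x) * g (toℕ j)) ≡ g x
sum-select {suc m} zero    g _         =
  trans (cong₂ _+_ (+-identityʳ (g 0)) (trans (sum-const m 0) (*-zeroʳ m))) (+-identityʳ (g 0))
sum-select {suc m} (suc x) g (s≤s x<m) = sum-select x (g ∘ suc) x<m

count-self : ∀ {n} (u : Fin n) → ∑[ v < n ] 𝟙 (v Fin.≟ u) ≡ 1
count-self {n} u = begin
  ∑[ v < n ] 𝟙 (v Fin.≟ u)                   ≡⟨ sum-cong-≗ same-indicator ⟩
  ∑[ v < n ] (𝟙 (toℕ v ≟ toℕ u) * 1)         ≡⟨ sum-select (toℕ u) (λ _ → 1) (Fin.toℕ<n u) ⟩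
  1                                          ∎
  where
  open ≡-Reasoning
  same-indicator : ∀ v → 𝟙 (v Fin.≟ u) ≡ 𝟙 (toℕ v ≟ toℕ u) * 1
  same-indicator v = trans (𝟙-cong (v Fin.≟ u) (toℕ v ≟ toℕ u) (cong toℕ) Fin.toℕ-injective)
                           (sym (*-identityʳ _))

am-gm-ordered : ∀ a c → 2 * (a * (a + c)) ≤ a * a + (a + c) * (a + c)
am-gm-ordered a c = begin
  2 * (a * (a + c))                  ≤⟨ m≤m+n _ (c * c) ⟩
  2 * (a * (a + c)) + c * c          ≡⟨ expand a c ⟩
  a * a + (a + c) * (a + c)          ∎
  where
  open ≤-Reasoning
  expand : ∀ a c → 2 * (a * (a + c)) + c * c ≡ a * a + (a + c) * (a + c)
  expand = solve-∀

am-gm : ∀ a b → 2 * (a * b) ≤ a * a + b * b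
am-gm a b with ≤-total a b
... | inj₁ a≤b with c , refl ← m≤n⇒∃[o]m+o≡n a≤b = am-gm-ordered a c
... | inj₂ b≤a with c , refl ← m≤n⇒∃[o]m+o≡n b≤a =
  subst₂ _≤_ (cong (2 *_) (*-comm b (b + c))) (+-comm (b * b) _) (am-gm-ordered b c)

square-of-sum : ∀ {D} (x : Fin D → ℕ) → sum x * sum x ≡ ∑[ i < D ] ∑[ j < D ] (x i * x j)
square-of-sum x = trans (*-distribʳ-sum (sum x) x) (sum-cong-≗ (λ i → *-distribˡ-sum (x i) x))

-- Cauchy–Schwarz in the form (Σ xᵢ)² ≤ D · Σ xᵢ²: the pairwise products are
-- bounded by the average of the squares (am-gm), summed over all pairs.
cauchy-schwarz : ∀ {D} (x : Fin D → ℕ) → sum x * sum x ≤ D * ∑[ i < D ] (x i * x i)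
cauchy-schwarz {D} x = *-cancelˡ-≤ 2 (begin
  2 * (sum x * sum x)                                  ≡⟨ cong (2 *_) (square-of-sum x) ⟩
  2 * ∑[ i < D ] ∑[ j < D ] (x i * x j)                ≡⟨ double-distrib ⟩
  ∑[ i < D ] ∑[ j < D ] (2 * (x i * x j))              ≤⟨ sum-mono (λ i → sum-mono (λ j → am-gm (x i) (x j))) ⟩
  ∑[ i < D ] ∑[ j < D ] (x i * x i + x j * x j)        ≡⟨ sum-cong-≗ (λ i → ∑-distrib-+ (λ _ → x i * x i) sq) ⟩
  ∑[ i < D ] (∑[ j < D ] (x i * x i) + Q)              ≡⟨ sum-cong-≗ (λ i → cong (_+ Q) (sum-const D (x i * x i))) ⟩
  ∑[ i < D ] (D * (x i * x i) + Q)                     ≡⟨ ∑-distrib-+ (λ i → D * sq i) (λ _ → Q) ⟩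
  ∑[ i < D ] (D * (x i * x i)) + ∑[ i < D ] Q          ≡⟨ cong₂ _+_ (sym (*-distribˡ-sum D sq)) (sum-const D Q) ⟩
  D * Q + D * Q                                        ≡⟨ cong (D * Q +_) (sym (+-identityʳ (D * Q))) ⟩
  2 * (D * Q)                                          ∎)
  where
  open ≤-Reasoning
  sq : Fin D → ℕ
  sq i = x i * x i
  Q : ℕ
  Q = sum sq
  double-distrib : 2 * ∑[ i < D ] ∑[ j < D ] (x i * x j) ≡ ∑[ i < D ] ∑[ j < D ] (2 * (x i * x j))
  double-distrib = trans (*-distribˡ-sum 2 (λ i → ∑[ j < D ] (x i * x j))) (sum-cong-≗ (λ i → *-distribˡ-sum 2 (λ j → x i * x j)))

level : ∀ {n} → (Fin n → ℕ) → ℕ → ℕ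
level {n} f j = ∑[ v < n ] 𝟙 (j ≟ f v)

collisions : ∀ {n} → (Fin n → ℕ) → ℕ
collisions {n} f = ∑[ u < n ] ∑[ v < n ] 𝟙 (f u ≟ f v)

sum-by-levels : ∀ {n d} (f : Fin n → ℕ) → (∀ u → f u ≤ d) → (g : ℕ → ℕ) →
                ∑[ u < n ] g (f u) ≡ ∑[ j < suc d ] (level f (toℕ j) * g (toℕ j))
sum-by-levels {n} {d} f f≤d g = begin
  ∑[ u < n ] g (f u)
    ≡⟨ sum-cong-≗ {n} (λ u → sym (sum-select (f u) g (s≤s (f≤d u)))) ⟩
  ∑[ u < n ] ∑[ j < suc d ] (𝟙 (toℕ j ≟ f u) * g (toℕ j))
    ≡⟨ ∑-comm {n} {suc d} (λ u j → 𝟙 (toℕ j ≟ f u) * g (toℕ j)) ⟩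
  ∑[ j < suc d ] ∑[ u < n ] (𝟙 (toℕ j ≟ f u) * g (toℕ j))
    ≡⟨ sum-cong-≗ {suc d} (λ j → sym (*-distribʳ-sum (g (toℕ j)) (λ u → 𝟙 (toℕ j ≟ f u)))) ⟩
  ∑[ j < suc d ] (level f (toℕ j) * g (toℕ j))
    ∎
  where open ≡-Reasoning

size-by-levels : ∀ {n d} (f : Fin n → ℕ) → (∀ u → f u ≤ d) →
                 n ≡ ∑[ j < suc d ] level f (toℕ j)
size-by-levels {n} {d} f f≤d = begin
  n                                          ≡⟨ sym (*-identityʳ n) ⟩
  n * 1                                      ≡⟨ sym (sum-const n 1) ⟩
  ∑[ u < n ] 1                               ≡⟨ sum-by-levels f f≤d (λ _ → 1) ⟩
  ∑[ j < suc d ] (level f (toℕ j) * 1)       ≡⟨ sum-cong-≗ {suc d} (λ j → *-identityʳ (level f (toℕ j))) ⟩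
  ∑[ j < suc d ] level f (toℕ j)             ∎
  where open ≡-Reasoning

collisions-by-levels : ∀ {n d} (f : Fin n → ℕ) → (∀ u → f u ≤ d) →
                       collisions f ≡ ∑[ j < suc d ] (level f (toℕ j) * level f (toℕ j))
collisions-by-levels f f≤d = sum-by-levels f f≤d (level f)

-- If f takes values in {0, …, d} and exactly one point lies at level 0, then
-- by Cauchy–Schwarz on the levels 1, …, d the collisions satisfy
-- d · collisions f ≥ d + (n - 1)².
collisions-lower-bound : ∀ {n d} (f : Fin n → ℕ) → (∀ u → f u ≤ d) → level f 0 ≡ 1 →
                         d + (n ∸ 1) * (n ∸ 1) ≤ d * collisions f
collisions-lower-bound {n} {d} f f≤d level₀ = begin
  d + (n ∸ 1) * (n ∸ 1)   ≡⟨ cong (λ m → d + (m ∸ 1) * (m ∸ 1)) n≡1+S ⟩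
  d + S * S               ≤⟨ +-monoʳ-≤ d (cauchy-schwarz s) ⟩
  d + d * Q               ≡⟨ sym (*-suc d Q) ⟩
  d * suc Q               ≡⟨ cong (d *_) (sym collisions≡1+Q) ⟩
  d * collisions f        ∎
  where
  open ≤-Reasoning
  s : Fin d → ℕ
  s j = level f (suc (toℕ j))
  S Q : ℕ
  S = sum s
  Q = ∑[ j < d ] (s j * s j)
  n≡1+S : n ≡ suc S
  n≡1+S = trans (size-by-levels f f≤d) (cong (_+ S) level₀)
  collisions≡1+Q : collisions f ≡ suc Q
  collisions≡1+Q = trans (collisions-by-levels f f≤d) (cong (λ m → m * m + Q) level₀)

select-subset : ∀ {n} {P : Fin n → Set} (P? : ∀ i → Dec (P i)) k →
                k ≤ ∑[ i < n ] 𝟙 (P? i) → ∃[ W ] (∣ W ∣ ≡ k × (∀ w → w ∈ W → P w))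
select-subset {n} P? zero _ = ⊥ , ∣⊥∣≡0 n , λ _ w∈⊥ → contradiction w∈⊥ ∉⊥
select-subset {suc n} P? (suc k) enough with P? fzero
... | yes P₀ with W , ∣W∣≡k , W⊆P ← select-subset (P? ∘ fsuc) k (≤-pred enough) =
  inside ∷ W , cong suc ∣W∣≡k , λ { fzero here → P₀ ; (fsuc w) (there w∈W) → W⊆P w w∈W }
... | no _  with W , ∣W∣≡k , W⊆P ← select-subset (P? ∘ fsuc) (suc k) enough =
  outside ∷ W , ∣W∣≡k , λ { (fsuc w) (there w∈W) → W⊆P w w∈W }

least-witness : ∀ {Q : ℕ → Set} → (∀ l → Dec (Q l)) → ∀ {m} → Q m →
                ∃[ l ] (Q l × (∀ l′ → l′ < l → ¬ Q l′))
least-witness {Q} Q? {m} = <-rec (λ m → Q m → ∃[ l ] (Q l × (∀ l′ → l′ < l → ¬ Q l′))) search m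
  where
  search : ∀ m → (∀ {l} → l < m → Q l → ∃[ l′ ] (Q l′ × (∀ l″ → l″ < l′ → ¬ Q l″))) →
           Q m → ∃[ l ] (Q l × (∀ l′ → l′ < l → ¬ Q l′))
  search m below Qm with anyUpTo? Q? m
  ... | yes (l , l<m , Ql) = below l<m Ql
  ... | no  none           = m , Qm , λ l l<m Ql → none (l , l<m , Ql)

module Distances {n} (G : Graph n) (adj? : ∀ u v → Dec (Adj G u v)) (connected : Connected G) where

  walk? : ∀ u w m → Dec (Walk G u w m)
  walk? u w zero with u Fin.≟ w
  ... | yes refl = yes []
  ... | no  u≢w  = no λ { [] → u≢w refl }
  walk? u w (suc m) with Fin.any? (λ v → adj? u v ×-dec walk? v w m)
  ... | yes (v , uv , walk) = yes (uv ∷ walk)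
  ... | no  none            = no λ { (uv ∷ walk) → none (_ , uv , walk) }

  shortest : ∀ u v → ∃[ m ] Dist G u v m
  shortest u v with m , Qm ← connected u v
               with l , walk , shorter ← least-witness (walk? u v) Qm = l , walk , shorter

  dist : Fin n → Fin n → ℕ
  dist u v = proj₁ (shortest u v)

  dist-isDist : ∀ u v → Dist G u v (dist u v)
  dist-isDist u v = proj₂ (shortest u v)

  dist-minimal : ∀ {u v l} → Walk G u v l → dist u v ≤ l
  dist-minimal {u} {v} {l} walk = ≮⇒≥ (λ l<d → proj₂ (dist-isDist u v) l l<d walk)

  dist-self : ∀ z → dist z z ≡ 0
  dist-self z = n≤0⇒n≡0 (dist-minimal [])

  dist≡0⇒≡ : ∀ {u z} → dist u z ≡ 0 → u ≡ z
  dist≡0⇒≡ {u} {z} d≡0 with [] ← subst (Walk G u z) d≡0 (proj₁ (dist-isDist u z)) = refl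

  distance-zero-level : ∀ z → level (λ u → dist u z) 0 ≡ 1
  distance-zero-level z = trans (sum-cong-≗ {n} same) (count-self z)
    where
    same : ∀ v → 𝟙 (0 ≟ dist v z) ≡ 𝟙 (v Fin.≟ z)
    same v = 𝟙-cong (0 ≟ dist v z) (v Fin.≟ z) (dist≡0⇒≡ ∘ sym)
                    (λ { refl → sym (dist-self z) })

  agree : Fin n → Fin n → ℕ
  agree u v = ∑[ z < n ] 𝟙 (dist u z ≟ dist v z)

  agree≤n : ∀ u v → agree u v ≤ n
  agree≤n u v = begin
    agree u v      ≤⟨ sum-mono (λ z → 𝟙≤1 (dist u z ≟ dist v z)) ⟩
    ∑[ z < n ] 1   ≡⟨ sum-const n 1 ⟩
    n * 1          ≡⟨ *-identityʳ n ⟩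
    n              ∎
    where open ≤-Reasoning

  -- If every k-set resolves G, distinct vertices agree on fewer than k vertices:
  -- otherwise k agreeing vertices would form a k-set not separating them.
  agree-resolved : ∀ k → (∀ W → ∣ W ∣ ≡ k → Resolving G W) →
                   ∀ u v → k ≤ agree u v → u ≡ v
  agree-resolved k resolving u v k≤agree
    with W , ∣W∣≡k , W-agrees ← select-subset (λ z → dist u z ≟ dist v z) k k≤agree =
    resolving W ∣W∣≡k u v λ w w∈W →
      dist u w , dist-isDist u w , subst (Dist G v w) (sym (W-agrees w w∈W)) (dist-isDist v w)

  agree-double-count : ∑[ u < n ] ∑[ v < n ] agree u v ≡ ∑[ z < n ] collisions (λ u → dist u z)
  agree-double-count = begin
    ∑[ u < n ] ∑[ v < n ] ∑[ z < n ] δ u v z   ≡⟨ sum-cong-≗ {n} (λ u → ∑-comm {n} {n} (δ u)) ⟩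
    ∑[ u < n ] ∑[ z < n ] ∑[ v < n ] δ u v z   ≡⟨ ∑-comm {n} {n} (λ u z → ∑[ v < n ] δ u v z) ⟩
    ∑[ z < n ] ∑[ u < n ] ∑[ v < n ] δ u v z   ∎
    where
    open ≡-Reasoning
    δ : Fin n → Fin n → Fin n → ℕ
    δ u v z = 𝟙 (dist u z ≟ dist v z)

  -- Upper bound: if distinct vertices agree on at most κ vertices, each row
  -- Σ_v agree u v is at most n (from v = u) plus κ for each v.
  agree-total-upper : ∀ κ → (∀ u v → u ≢ v → agree u v ≤ κ) →
                      ∑[ u < n ] ∑[ v < n ] agree u v ≤ n * (n * suc κ)
  agree-total-upper κ distinct≤κ = begin
    ∑[ u < n ] ∑[ v < n ] agree u v  ≤⟨ sum-mono row ⟩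
    ∑[ u < n ] (n * suc κ)           ≡⟨ sum-const n (n * suc κ) ⟩
    n * (n * suc κ)                  ∎
    where
    open ≤-Reasoning
    entry : ∀ u v → agree u v ≤ n * 𝟙 (v Fin.≟ u) + κ
    entry u v with v Fin.≟ u
    ... | yes refl = ≤-trans (agree≤n u u) (≤-trans (≤-reflexive (sym (*-identityʳ n))) (m≤m+n (n * 1) κ))
    ... | no  v≢u  = ≤-trans (distinct≤κ u v (v≢u ∘ sym)) (m≤n+m κ (n * 0))
    row : ∀ u → ∑[ v < n ] agree u v ≤ n * suc κ
    row u = begin
      ∑[ v < n ] agree u v                                  ≤⟨ sum-mono (entry u) ⟩
      ∑[ v < n ] (n * 𝟙 (v Fin.≟ u) + κ)                    ≡⟨ ∑-distrib-+ (λ v → n * 𝟙 (v Fin.≟ u)) (λ _ → κ) ⟩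
      ∑[ v < n ] (n * 𝟙 (v Fin.≟ u)) + ∑[ v < n ] κ         ≡⟨ cong₂ _+_ (sym (*-distribˡ-sum n (λ v → 𝟙 (v Fin.≟ u)))) (sum-const n κ) ⟩
      n * ∑[ v < n ] 𝟙 (v Fin.≟ u) + n * κ                  ≡⟨ cong (λ c → n * c + n * κ) (count-self u) ⟩
      n * 1 + n * κ                                         ≡⟨ sym (*-distribˡ-+ n 1 κ) ⟩
      n * suc κ                                             ∎

  agree-total-lower : ∀ d → (∀ u v → dist u v ≤ d) →
                      n * (d + (n ∸ 1) * (n ∸ 1)) ≤ d * ∑[ u < n ] ∑[ v < n ] agree u v
  agree-total-lower d dist≤d = begin
    n * (d + (n ∸ 1) * (n ∸ 1))                 ≡⟨ sym (sum-const n _) ⟩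
    ∑[ z < n ] (d + (n ∸ 1) * (n ∸ 1))          ≤⟨ sum-mono per-vertex ⟩
    ∑[ z < n ] (d * collisions (λ u → dist u z)) ≡⟨ sym (*-distribˡ-sum d (λ z → collisions (λ u → dist u z))) ⟩
    d * ∑[ z < n ] collisions (λ u → dist u z)  ≡⟨ cong (d *_) (sym agree-double-count) ⟩
    d * ∑[ u < n ] ∑[ v < n ] agree u v         ∎
    where
    open ≤-Reasoning
    per-vertex : ∀ z → d + (n ∸ 1) * (n ∸ 1) ≤ d * collisions (λ u → dist u z)
    per-vertex z = collisions-lower-bound (λ u → dist u z) (λ u → dist≤d u z) (distance-zero-level z)

-- Arithmetic core: d + N² ≤ d (N+1) k forces N ≤ k d.  Were k d < N, then
-- N² ≥ N (k d + 1) would give d + N ≤ k d < N.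
square-bound : ∀ N d k → d + N * N ≤ d * (suc N * k) → N ≤ k * d
square-bound N d k h with N ≤? k * d
... | yes N≤kd = N≤kd
... | no  N≰kd = contradiction (≤-trans (m≤n+m N d) d+N≤kd) N≰kd
  where
  open ≤-Reasoning
  d+N≤kd : d + N ≤ k * d
  d+N≤kd = +-cancelʳ-≤ (N * (k * d)) (d + N) (k * d) (begin
    d + N + N * (k * d)    ≡⟨ regroup N d (k * d) ⟩
    d + N * suc (k * d)    ≤⟨ +-monoʳ-≤ d (*-monoʳ-≤ N (≰⇒> N≰kd)) ⟩
    d + N * N              ≤⟨ h ⟩
    d * (suc N * k)        ≡⟨ expand N d k ⟩
    k * d + N * (k * d)    ∎)
    where
    regroup : ∀ N d p → d + N + N * p ≡ d + N * suc p
    regroup = solve-∀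
    expand : ∀ N d k → d * (suc N * k) ≡ k * d + N * (k * d)
    expand = solve-∀

-- The vertex argument only
-- records that the graph is nonempty, so that the factor n can be cancelled.
order-bound : ∀ {n} (G : Graph n) (adj? : ∀ u v → Dec (Adj G u v)) (connected : Connected G) →
              let open Distances G adj? connected in
              ∀ d κ → (∀ u v → dist u v ≤ d) → (∀ u v → u ≢ v → agree u v ≤ κ) →
              Fin n → n ∸ 1 ≤ suc κ * d
order-bound {suc N} G adj? connected d κ dist≤d distinct≤κ _ =
  square-bound N d (suc κ) (*-cancelˡ-≤ (suc N) (begin
    suc N * (d + N * N)                          ≤⟨ agree-total-lower d dist≤d ⟩
    d * ∑[ u < suc N ] ∑[ v < suc N ] agree u v  ≤⟨ *-monoʳ-≤ d (agree-total-upper κ distinct≤κ) ⟩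
    d * (suc N * (suc N * suc κ))                ≡⟨ swap-factors d (suc N) (suc N * suc κ) ⟩
    suc N * (d * (suc N * suc κ))                ∎))
  where
  open Distances G adj? connected
  open ≤-Reasoning
  swap-factors : ∀ a b c → a * (b * c) ≡ b * (a * c)
  swap-factors = solve-∀

¬¬-all-Fin : ∀ {n} {P : Fin n → Set} → (∀ i → ¬ ¬ P i) → ¬ ¬ (∀ i → P i)
¬¬-all-Fin {zero}  _      none = none λ ()
¬¬-all-Fin {suc n} ¬¬P none =
  ¬¬P fzero λ P₀ → ¬¬-all-Fin (¬¬P ∘ fsuc) λ P₊ → none λ { fzero → P₀ ; (fsuc i) → P₊ i }

¬¬-adjacency-decidable : ∀ {n} (G : Graph n) → ¬ ¬ (∀ u v → Dec (Adj G u v))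
¬¬-adjacency-decidable G = ¬¬-all-Fin λ u → ¬¬-all-Fin λ v → ¬¬-excluded-middle

resolving-k-sets-bound : ∀ {n} k d (G : Graph n) (adj? : ∀ u v → Dec (Adj G u v)) →
                         (connected : Connected G) → (∀ u v m → Dist G u v m → m ≤ d) →
                         (∀ W → ∣ W ∣ ≡ k → Resolving G W) → n ∸ 1 ≤ k * d
resolving-k-sets-bound {zero}        _       _ _ _    _         _        _         = z≤n
resolving-k-sets-bound {suc zero}    _       _ _ _    _         _        _         = z≤n
resolving-k-sets-bound {suc (suc N)} zero    d G adj? connected _        resolving =
  contradiction (Distances.agree-resolved G adj? connected 0 resolving fzero (fsuc fzero) z≤n) λ ()
resolving-k-sets-bound {suc N}       (suc κ) d G adj? connected diameter resolving =
  order-bound G adj? connected d κ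
    (λ u v → diameter u v (dist u v) (dist-isDist u v))
    (λ u v u≢v → ≤-pred (≰⇒> (u≢v ∘ agree-resolved (suc κ) resolving u v)))
    fzero
  where open Distances G adj? connected

mainTheorem3 : ∀ (n k d : ℕ) (G : Graph n) → Connected G → Diameter G d →
               RandomlyKDim G k → n ∸ 1 ≤ k * d
mainTheorem3 n k d G connected (_ , diameter) (_ , k-sets-are-bases) =
  decidable-stable (n ∸ 1 ≤? k * d) λ ¬bound →
    ¬¬-adjacency-decidable G λ adj? →
      ¬bound (resolving-k-sets-bound k d G adj? connected diameter
                (λ W ∣W∣≡k → proj₁ (k-sets-are-bases W ∣W∣≡k)))
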